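{- For a connected skew shape $\lambda/\mu$, for every $T\in\mathrm{SSYT}_{\min}(\lambda/\mu)$ the tableau $T+\mathbf 1_{\lambda/\mu}$ (add $1$ to every entry) belongs to $\mathcal{SF}(\lambda/\mu)$.
   Context: $[\lambda]=\{(i,j):1\le i\le\ell(\lambda),1\le j\le\lambda_i\}$ (English convention), $\lambda'$ conjugate, $[\lambda/\mu]=[\lambda]\setminus[\mu]$, assumed connected. An SSYT of shape $\lambda/\mu$ is a filling of $[\lambda/\mu]$ by integers weakly increasing in rows and strictly increasing down columns (entries of minimal SSYT are nonnegative). $\mathcal{SF}(\lambda/\mu)$ is the set of SSYT of shape $\lambda/\mu$ with positive integer entries such that every entry in row $i$ is at most $i$. Lascoux–Pragacz strips: a border strip is a connected skew shape with no $2\times2$ square; for $\varepsilon\ge0$ let $L_\varepsilon=\{(i,j)\in[\lambda/\mu]:(i+\varepsilon,j+\varepsilon)\in[\lambda/\mu],(i+\varepsilon+1,j+\varepsilon+1)\notin[\lambda]\}$; the connected components of all $L_\varepsilon$, in decreasing order of the content $j-i$ of their NE-most cell, are $\theta_1,\dots,\theta_k$. $\mathsf f(\theta_r)$ is the row of the NE-most cell of $\theta_r$, $ht_{\theta_r}(i)=i-\mathsf f(\theta_r)$, $\theta_r(j)$ the cells of $\theta_r$ in column $j$. Minimal SSYT: $T_0(i,j)=i-\mu'_j-1$. For an SSYT $T$, a nonempty $\theta_k(j)$ with top cell $(i,j)$ and bottom $(i',j)$ is active if $T(i,j)<ht_{\theta_k}(i)$, $T(i,j)<T(i,j+1)$ and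 $T(i',j)<T(i'+1,j)-1$ (each imposed when the relevant cell lies in $[\lambda/\mu]$); the move adds $1$ to all entries of an active $\theta_k(j)$. $\mathrm{SSYT}_{\min}(\lambda/\mu)$ is the set of tableaux obtained from $T_0$ by finite sequences of such moves. -}

module Defs where

open import Data.Nat using (ℕ; zero; suc; _+_; _∸_; _≤_; _<_; _≥_; _≤?_)
open import Data.List using (List; []; _∷_; length; filter)
open import Data.List.Relation.Unary.All using (All)
open import Data.List.Relation.Unary.Linked using (Linked)
open import Data.Product using (Σ; ∃; _×_; _,_)
open import Relation.Binary.PropositionalEquality using (_≡_)
open import Relation.Nullary using (¬_)

IsPartition : List ℕ → Set
IsPartition λ′ = Linked _≥_ λ′ × All (λ x → 0 < x) λ′

-- part λ i = λ_i  (1-indexed; 0 beyond the length, and for i = 0)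
part : List ℕ → ℕ → ℕ
part xs zero = 0
part [] (suc i) = 0
part (x ∷ xs) (suc zero) = x
part (x ∷ xs) (suc (suc i)) = part xs (suc i)

conj : List ℕ → ℕ → ℕ
conj xs j = length (filter (j ≤?_) xs)

Cell : Set
Cell = ℕ × ℕ   -- (row i, column j), 1-indexed, English convention

InDiagram : List ℕ → Cell → Set
InDiagram λ′ (i , j) = 1 ≤ i × 1 ≤ j × j ≤ part λ′ i

InSkew : List ℕ → List ℕ → Cell → Set
InSkew λ′ μ c = InDiagram λ′ c × ¬ InDiagram μ c

data Adj : Cell → Cell → Set where
  right : ∀ {i j} → Adj (i , j) (i , suc j)
  left  : ∀ {i j} → Adj (i , suc j) (i , j)
  down  : ∀ {i j} → Adj (i , j) (suc i , j)
  up    : ∀ {i j} → Adj (suc i , j) (i , j)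

data Path (P : Cell → Set) : Cell → Cell → Set where
  here : ∀ {c} → P c → Path P c c
  step : ∀ {c d e} → P c → Adj c d → Path P d e → Path P c e

Connected : List ℕ → List ℕ → Set
Connected λ′ μ = ∀ c d → InSkew λ′ μ c → InSkew λ′ μ d → Path (InSkew λ′ μ) c d

L : List ℕ → List ℕ → ℕ → Cell → Set
L λ′ μ ε (i , j) =
  InSkew λ′ μ (i , j) × InSkew λ′ μ (i + ε , j + ε)
  × ¬ InDiagram λ′ (suc (i + ε) , suc (j + ε))

-- c and d lie in the same Lascoux–Pragacz strip: the same connected
-- component of some L_ε
SameStrip : List ℕ → List ℕ → Cell → Cell → Set
SameStrip λ′ μ c d = ∃ λ ε → Path (L λ′ μ ε) c d

-- content comparison:  content (i,j) ≤ content (i',j')  i.e.  j - i ≤ j' - i'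
_≤ᶜ_ : Cell → Cell → Set
(i , j) ≤ᶜ (i' , j') = j + i' ≤ j' + i

IsHead : List ℕ → List ℕ → Cell → Set
IsHead λ′ μ h = InSkew λ′ μ h × (∀ c → SameStrip λ′ μ h c → c ≤ᶜ h)

-- h is the NE-most cell of the last strip θ_k (strips ordered by
-- decreasing content of their NE-most cells)
IsLastHead : List ℕ → List ℕ → Cell → Set
IsLastHead λ′ μ h = IsHead λ′ μ h × (∀ h' → IsHead λ′ μ h' → h ≤ᶜ h')

InStrip : List ℕ → List ℕ → Cell → Cell → Set
InStrip λ′ μ h c = SameStrip λ′ μ h c

-- tableaux: functions on cells (only values on [λ/μ] matter)
Tableau : Set
Tableau = ℕ → ℕ → ℕ

T₀ : List ℕ → Tableau
T₀ μ i j = i ∸ conj μ j ∸ 1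

-- ht_θ(i) = i - f(θ), where f(θ) is the row of the head h
ht : Cell → ℕ → ℕ
ht (f , _) i = i ∸ f

ColumnPiece : List ℕ → List ℕ → Cell → ℕ → ℕ → ℕ → Set
ColumnPiece λ′ μ h j i i' =
  InStrip λ′ μ h (i , j) × InStrip λ′ μ h (i' , j)
  × (∀ r → InStrip λ′ μ h (r , j) → i ≤ r × r ≤ i')

Active : List ℕ → List ℕ → Cell → Tableau → ℕ → ℕ → ℕ → Set
Active λ′ μ h T j i i' =
  ColumnPiece λ′ μ h j i i'
  × T i j < ht h i
  × (InSkew λ′ μ (i , suc j) → T i j < T i (suc j))
  × (InSkew λ′ μ (suc i' , j) → suc (T i' j) < T (suc i') j)

Move : List ℕ → List ℕ → Cell → Tableau → ℕ → Tableau → Set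
Move λ′ μ h T j T' =
  ∀ r c → ((c ≡ j × InStrip λ′ μ h (r , c)) → T' r c ≡ suc (T r c))
        × (¬ (c ≡ j × InStrip λ′ μ h (r , c)) → T' r c ≡ T r c)

data SSYTmin (λ′ μ : List ℕ) (h : Cell) : Tableau → Set where
  base : SSYTmin λ′ μ h (T₀ μ)
  move : ∀ {T T' j i i'} → SSYTmin λ′ μ h T → Active λ′ μ h T j i i'
       → Move λ′ μ h T j T' → SSYTmin λ′ μ h T'

IsSSYT : List ℕ → List ℕ → Tableau → Set
IsSSYT λ′ μ T =
  (∀ i j → InSkew λ′ μ (i , j) → InSkew λ′ μ (i , suc j) → T i j ≤ T i (suc j))
  × (∀ i j → InSkew λ′ μ (i , j) → InSkew λ′ μ (suc i , j) → T i j < T (suc i) j)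

InSF : List ℕ → List ℕ → Tableau → Set
InSF λ′ μ T =
  IsSSYT λ′ μ T × (∀ i j → InSkew λ′ μ (i , j) → 1 ≤ T i j × T i j ≤ i)

plusOne : Tableau → Tableau
plusOne T i j = suc (T i j)

-- Every tableau reachable from T₀ satisfies three invariants: it is semistandard
-- on λ/μ, entries in row r are less than r, and along each column piece of the
-- moved strip θ the entries grow by exactly one per row.  The last one makes a
-- move act on θ(j) as a shift of a chain whose top entry is bounded by
-- ht_θ(i) = i − f(θ) and whose rows to the right dominate it, so the move
-- keeps all three properties.  Adding 1 to such a tableau gives an element of
-- 𝒮ℱ(λ/μ).
module Submission where

open import Defs
open import Data.Empty using (⊥-elim)
open import Data.List using (List; []; _∷_; length)
open import Data.List.Properties using (filter-none; filter-accept; filter-reject)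
open import Data.List.Relation.Unary.All using (All)
import Data.List.Relation.Unary.All as All
open import Data.List.Relation.Unary.Linked using (Linked; []; [-]; _∷_; tail)
open import Data.List.Relation.Unary.Linked.Properties using (Linked⇒All)
open import Data.List.Relation.Binary.Sublist.Propositional using (⊆-refl)
open import Data.List.Relation.Binary.Sublist.Propositional.Properties
  using (filter⁺; length-mono-≤)
open import Data.Nat
  using (ℕ; zero; suc; _+_; _∸_; _≤_; _<_; _≥_; _≤′_; _≤?_; _≟_; z≤n; s≤s; ≤′-refl; ≤′-step)
open import Data.Nat.Properties
open import Algebra.Properties.CommutativeSemigroup +-commutativeSemigroup using (xy∙z≈xz∙y)
open import Data.Product using (_×_; _,_; proj₁; proj₂)
open import Function using (_∘_; flip)
open import Relation.Binary.Definitions using (tri<; tri≈; tri>)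
open import Relation.Binary.PropositionalEquality
open import Relation.Nullary using (¬_; Dec; yes; no)
open import Relation.Nullary.Decidable using (_×-dec_)

<∸⇒suc< : ∀ {y i f} → 1 ≤ f → y < i ∸ f → suc y < i
<∸⇒suc< {i = suc i} {f = suc f} _ y<i∸f = s≤s (≤-trans y<i∸f (m∸n≤m i f))

part-step-antitone : ∀ {xs} → Linked _≥_ xs → ∀ i → part xs (suc (suc i)) ≤ part xs (suc i)
part-step-antitone []          i       = z≤n
part-step-antitone [-]         i       = z≤n
part-step-antitone (x≥y ∷ _)   zero    = x≥y
part-step-antitone (_ ∷ xs↓)   (suc i) = part-step-antitone xs↓ i

part-antitone : ∀ {xs} → Linked _≥_ xs → ∀ {i i'} → 1 ≤ i → i ≤ i' → part xs i' ≤ part xs i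
part-antitone {xs} xs↓ {suc i} _ (s≤s i≤i') = go (≤⇒≤′ i≤i')
  where
  go : ∀ {i'} → i ≤′ i' → part xs (suc i') ≤ part xs (suc i)
  go ≤′-refl        = ≤-refl
  go (≤′-step i≤′i') = ≤-trans (part-step-antitone xs↓ _) (go i≤′i')

diagram-downClosed : ∀ {xs} → Linked _≥_ xs → ∀ {i j i' j'} → InDiagram xs (i , j)
  → 1 ≤ i' → 1 ≤ j' → i' ≤ i → j' ≤ j → InDiagram xs (i' , j')
diagram-downClosed xs↓ (_ , _ , j≤) 1≤i' 1≤j' i'≤i j'≤j =
  1≤i' , 1≤j' , ≤-trans j'≤j (≤-trans j≤ (part-antitone xs↓ 1≤i' i'≤i))

conj-antitone : ∀ xs c → conj xs (suc c) ≤ conj xs c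
conj-antitone xs c =
  length-mono-≤ (filter⁺ (suc c ≤?_) (c ≤?_) (λ { refl → ≤-trans (n≤1+n c) }) (⊆-refl {x = xs}))

conj-cons-≤ : ∀ x xs c → conj (x ∷ xs) c ≤ suc (conj xs c)
conj-cons-≤ x xs c with c ≤? x
... | yes c≤x = ≤-reflexive (cong length (filter-accept (c ≤?_) c≤x))
... | no c≰x  = ≤-trans (≤-reflexive (cong length (filter-reject (c ≤?_) c≰x))) (n≤1+n _)

conj-≤-row : ∀ {xs} → Linked _≥_ xs → ∀ r {c} → part xs (suc r) < c → conj xs c ≤ r
conj-≤-row {[]}     _   r       _   = z≤n
conj-≤-row {x ∷ xs} xs↓ zero    {c} x<c =
  ≤-reflexive (cong length (filter-none (c ≤?_) all-below-c))
  where
  all-below-c : All (λ y → ¬ c ≤ y) (x ∷ xs)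
  all-below-c = All.map (λ y≤x → <⇒≱ (≤-<-trans y≤x x<c)) (Linked⇒All (flip ≤-trans) ≤-refl xs↓)
conj-≤-row {x ∷ xs} xs↓ (suc r) {c} lt =
  ≤-trans (conj-cons-≤ x xs c) (s≤s (conj-≤-row (tail xs↓) r lt))

outside-conj< : ∀ {xs} → Linked _≥_ xs → ∀ {r c} → 1 ≤ r → 1 ≤ c
  → ¬ InDiagram xs (r , c) → conj xs c < r
outside-conj< xs↓ {suc r} 1≤r 1≤c out = s≤s (conj-≤-row xs↓ r (≰⇒> λ c≤ → out (1≤r , 1≤c , c≤)))

-- T₀ has no junk subtraction on λ/μ: there μ'_c < r.
T₀-offset : ∀ μ {r c} → conj μ c < r → T₀ μ r c + suc (conj μ c) ≡ r
T₀-offset μ {r} {c} q<r = begin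
  r ∸ q ∸ 1 + suc q    ≡⟨ cong (_+ suc q) (∸-+-assoc r q 1) ⟩
  r ∸ (q + 1) + suc q  ≡⟨ cong (λ n → r ∸ n + suc q) (+-comm q 1) ⟩
  r ∸ suc q + suc q    ≡⟨ m∸n+n≡m q<r ⟩
  r                    ∎
  where
  open ≡-Reasoning
  q : ℕ
  q = conj μ c

column-strict-chain : ∀ {P : Cell → Set} {T : Tableau}
  → (∀ m {a b c} → P (a , c) → P (b , c) → a ≤ m → m ≤ b → P (m , c))
  → (∀ i j → P (i , j) → P (suc i , j) → T i j < T (suc i) j)
  → ∀ {i c} k → P (i , c) → P (i + k , c) → T i c + k ≤ T (i + k) c
column-strict-chain {T = T} _ _ {i} {c} zero _ _ rewrite +-identityʳ i = ≤-reflexive (+-identityʳ (T i c))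
column-strict-chain {P} {T} convex col {i} {c} (suc k) top bot rewrite +-suc (T i c) k | +-suc i k =
  ≤-trans (s≤s (column-strict-chain convex col k top mid)) (col (i + k) c mid bot)
  where
  mid : P (i + k , c)
  mid = convex (i + k) top bot (m≤m+n i k) (n≤1+n (i + k))

module SkewShape {λ′ μ : List ℕ} (λ↓ : Linked _≥_ λ′) (μ↓ : Linked _≥_ μ) where

  Sk : Cell → Set
  Sk = InSkew λ′ μ

  S : Cell → Cell → Set
  S = InStrip λ′ μ

  skew-conj< : ∀ {r c} → Sk (r , c) → conj μ c < r
  skew-conj< ((1≤r , 1≤c , _) , out) = outside-conj< μ↓ 1≤r 1≤c out

  outside-upClosed : ∀ {a b a' b'} → ¬ InDiagram μ (a , b) → 1 ≤ a → 1 ≤ b → a ≤ a' → b ≤ b'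
    → ¬ InDiagram μ (a' , b')
  outside-upClosed out 1≤a 1≤b a≤a' b≤b' inside =
    out (diagram-downClosed μ↓ inside 1≤a 1≤b a≤a' b≤b')

  skew-column-convex : ∀ m {a b c} → Sk (a , c) → Sk (b , c) → a ≤ m → m ≤ b → Sk (m , c)
  skew-column-convex m ((1≤a , 1≤c , _) , out) ((_ , _ , c≤λb) , _) a≤m m≤b =
    (1≤m , 1≤c , ≤-trans c≤λb (part-antitone λ↓ 1≤m m≤b)) , outside-upClosed out 1≤a 1≤c a≤m ≤-refl
    where
    1≤m : 1 ≤ m
    1≤m = ≤-trans 1≤a a≤m

  skew-right-above : ∀ {r i j} → Sk (r , suc j) → Sk (i , j) → i ≤ r → Sk (i , suc j)
  skew-right-above ((_ , _ , j<λr) , _) ((1≤i , 1≤j , _) , out) i≤r =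
    (1≤i , s≤s z≤n , ≤-trans j<λr (part-antitone λ↓ 1≤i i≤r)) , outside-upClosed out 1≤i 1≤j ≤-refl (n≤1+n _)

  L-index-< : ∀ {ε ε' a b} → ε < ε' → L λ′ μ ε' (a , b) → InDiagram λ′ (suc (a + ε) , suc (b + ε))
  L-index-< {a = a} {b} ε<ε' (_ , (inλ , _) , _) =
    diagram-downClosed λ↓ inλ (s≤s z≤n) (s≤s z≤n) (+-monoʳ-< a ε<ε') (+-monoʳ-< b ε<ε')

  L-index-unique : ∀ {ε ε' c} → L λ′ μ ε c → L λ′ μ ε' c → ε ≡ ε'
  L-index-unique {ε} {ε'} l l' with <-cmp ε ε'
  ... | tri< ε<ε' _ _ = ⊥-elim (proj₂ (proj₂ l) (L-index-< ε<ε' l'))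
  ... | tri≈ _ ε≡ε' _ = ε≡ε'
  ... | tri> _ _ ε'<ε = ⊥-elim (proj₂ (proj₂ l') (L-index-< ε'<ε l))

  path-start : ∀ {P c d} → Path P c d → P c
  path-start (here p)     = p
  path-start (step p _ _) = p

  path-end : ∀ {P c d} → Path P c d → P d
  path-end (here p)      = p
  path-end (step _ _ ps) = path-end ps

  path-snoc : ∀ {P c d e} → Path P c d → P e → Adj d e → Path P c e
  path-snoc (here p)        pe d~e = step p d~e (here pe)
  path-snoc (step p c~ ps)  pe d~e = step p c~ (path-snoc ps pe d~e)

  strip⇒skew : ∀ {h c} → S h c → Sk c
  strip⇒skew (_ , path) = proj₁ (path-end path)

  -- Both cells lie in the same L_ε, since the paths start at the common head.
  strip-column-step : ∀ {h a b j} → S h (a , j) → S h (b , j) → a < b → S h (suc a , j)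
  strip-column-step {a = a} {b} {j} (ε , pa) (ε' , pb) a<b
    with L-index-unique (path-start pa) (path-start pb)
  ... | refl = ε , path-snoc pa below down
    where
    la : L λ′ μ ε (a , j)
    la = path-end pa
    lb : L λ′ μ ε (b , j)
    lb = path-end pb
    below : L λ′ μ ε (suc a , j)
    below = skew-column-convex (suc a) (proj₁ la) (proj₁ lb) (n≤1+n a) a<b
          , skew-column-convex (suc a + ε) (proj₁ (proj₂ la)) (proj₁ (proj₂ lb)) (n≤1+n _) (+-monoˡ-≤ ε a<b)
          , λ inλ → proj₂ (proj₂ la) (diagram-downClosed λ↓ inλ (s≤s z≤n) (s≤s z≤n) (n≤1+n _) ≤-refl)

  strip-column-convex : ∀ {h a b r j} → S h (a , j) → S h (b , j) → a ≤ r → r ≤ b → S h (r , j)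
  strip-column-convex {h} {a} {b} {j = j} sa sb a≤r r≤b = go (≤⇒≤′ a≤r) r≤b
    where
    go : ∀ {r} → a ≤′ r → r ≤ b → S h (r , j)
    go ≤′-refl         _   = sa
    go (≤′-step a≤′r) r<b = strip-column-step (go a≤′r (<⇒≤ r<b)) sb r<b

  record Invariant (h : Cell) (T : Tableau) : Set where
    field
      row-weak    : ∀ i j → Sk (i , j) → Sk (i , suc j) → T i j ≤ T i (suc j)
      col-strict  : ∀ i j → Sk (i , j) → Sk (suc i , j) → T i j < T (suc i) j
      below-row   : ∀ r c → Sk (r , c) → T r c < r
      strip-shift : ∀ r k c → S h (r , c) → S h (r + k , c) → T (r + k) c ≡ T r c + k

  T₀-invariant : ∀ {h} → Invariant h (T₀ μ)
  T₀-invariant = record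
    { row-weak    = λ i j s s→ → +-cancelʳ-≤ (suc (conj μ (suc j))) _ _ (begin
        T₀ μ i j + suc (conj μ (suc j)) ≤⟨ +-monoʳ-≤ (T₀ μ i j) (s≤s (conj-antitone μ j)) ⟩
        T₀ μ i j + suc (conj μ j)       ≡⟨ offset s ⟩
        i                               ≡⟨ offset s→ ⟨
        T₀ μ i (suc j) + suc (conj μ (suc j)) ∎)
    ; col-strict  = λ i j s s↓ → ≤-reflexive (+-cancelʳ-≡ (suc (conj μ j)) _ _ (trans (cong suc (offset s)) (sym (offset s↓))))
    ; below-row   = λ r c s → begin-strict
        T₀ μ r c                   ≤⟨ m≤m+n _ (conj μ c) ⟩
        T₀ μ r c + conj μ c        <⟨ +-monoʳ-< (T₀ μ r c) (n<1+n (conj μ c)) ⟩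
        T₀ μ r c + suc (conj μ c)  ≡⟨ offset s ⟩
        r                          ∎
    ; strip-shift = λ r k c s s' → +-cancelʳ-≡ (suc (conj μ c)) _ _ (begin-equality
        T₀ μ (r + k) c + suc (conj μ c) ≡⟨ offset (strip⇒skew s') ⟩
        r + k                           ≡⟨ cong (_+ k) (offset (strip⇒skew s)) ⟨
        T₀ μ r c + suc (conj μ c) + k   ≡⟨ xy∙z≈xz∙y (T₀ μ r c) (suc (conj μ c)) k ⟩
        T₀ μ r c + k + suc (conj μ c)   ∎)
    }
    where
    open ≤-Reasoning
    offset : ∀ {r c} → Sk (r , c) → T₀ μ r c + suc (conj μ c) ≡ r
    offset s = T₀-offset μ (skew-conj< s)

  module MovePreserves {f b : ℕ} (1≤f : 1 ≤ f) {T T' : Tableau} {j i i' : ℕ}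
    (inv : Invariant (f , b) T) (act : Active λ′ μ (f , b) T j i i') (mv : Move λ′ μ (f , b) T j T')
    where

    open Invariant inv

    h : Cell
    h = (f , b)

    top-strip : S h (i , j)
    top-strip = proj₁ (proj₁ act)

    bottom-strip : S h (i' , j)
    bottom-strip = proj₁ (proj₂ (proj₁ act))

    piece-range : ∀ r → S h (r , j) → i ≤ r × r ≤ i'
    piece-range = proj₂ (proj₂ (proj₁ act))

    top<ht : T i j < i ∸ f
    top<ht = proj₁ (proj₂ act)

    top<right : Sk (i , suc j) → T i j < T i (suc j)
    top<right = proj₁ (proj₂ (proj₂ act))

    bottom<below : Sk (suc i' , j) → suc (T i' j) < T (suc i') j
    bottom<below = proj₂ (proj₂ (proj₂ act))

    InPiece : Cell → Set
    InPiece (r , c) = c ≡ j × i ≤ r × r ≤ i'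

    inPiece? : ∀ r c → Dec (InPiece (r , c))
    inPiece? r c = (c ≟ j) ×-dec (i ≤? r) ×-dec (r ≤? i')

    moved : ∀ {r c} → InPiece (r , c) → T' r c ≡ suc (T r c)
    moved {r} (refl , i≤r , r≤i') = proj₁ (mv r j) (refl , strip-column-convex top-strip bottom-strip i≤r r≤i')

    fixed : ∀ {r c} → ¬ InPiece (r , c) → T' r c ≡ T r c
    fixed {r} {c} out = proj₂ (mv r c) λ { (refl , s) → out (refl , piece-range r s) }

    piece-shift : ∀ k → i + k ≤ i' → T (i + k) j ≡ T i j + k
    piece-shift k le = strip-shift i k j top-strip (strip-column-convex top-strip bottom-strip (m≤m+n i k) le)

    moved-below-right : ∀ {r} → i ≤ r → r ≤ i' → Sk (r , suc j) → suc (T r j) ≤ T r (suc j)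
    moved-below-right i≤r r≤i' s→ with m≤n⇒∃[o]m+o≡n i≤r
    ... | k , refl = begin
      suc (T (i + k) j)   ≡⟨ cong suc (piece-shift k r≤i') ⟩
      suc (T i j) + k     ≤⟨ +-monoˡ-≤ k (top<right top-right) ⟩
      T i (suc j) + k     ≤⟨ column-strict-chain skew-column-convex col-strict k top-right s→ ⟩
      T (i + k) (suc j)   ∎
      where
      open ≤-Reasoning
      top-right : Sk (i , suc j)
      top-right = skew-right-above s→ (strip⇒skew top-strip) i≤r

    moved-below-row : ∀ {r} → i ≤ r → r ≤ i' → suc (T r j) < r
    moved-below-row i≤r r≤i' with m≤n⇒∃[o]m+o≡n i≤r
    ... | k , refl = begin-strict
      suc (T (i + k) j)   ≡⟨ cong suc (piece-shift k r≤i') ⟩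
      suc (T i j) + k     <⟨ +-monoˡ-< k (<∸⇒suc< 1≤f top<ht) ⟩
      i + k               ∎
      where open ≤-Reasoning

    moved-above-fixed : ∀ {r} → i ≤ r → r ≤ i' → ¬ InPiece (suc r , j) → Sk (suc r , j)
      → suc (T r j) < T (suc r) j
    moved-above-fixed i≤r r≤i' out s↓
      with ≤-antisym r≤i' (≮⇒≥ λ r<i' → out (refl , m≤n⇒m≤1+n i≤r , r<i'))
    ... | refl = bottom<below s↓

    row-weak′ : ∀ r c → Sk (r , c) → Sk (r , suc c) → T' r c ≤ T' r (suc c)
    row-weak′ r c s s→ with inPiece? r c | inPiece? r (suc c)
    ... | yes (refl , _) | yes (c+1≡c , _) = ⊥-elim (1+n≢n c+1≡c)
    ... | yes p@(refl , i≤r , r≤i') | no q rewrite moved p | fixed q = moved-below-right i≤r r≤i' s→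
    ... | no p | yes q rewrite fixed p | moved q = m≤n⇒m≤1+n (row-weak r c s s→)
    ... | no p | no q  rewrite fixed p | fixed q = row-weak r c s s→

    col-strict′ : ∀ r c → Sk (r , c) → Sk (suc r , c) → T' r c < T' (suc r) c
    col-strict′ r c s s↓ with inPiece? r c | inPiece? (suc r) c
    ... | yes p | yes q rewrite moved p | moved q = s≤s (col-strict r c s s↓)
    ... | yes p@(refl , i≤r , r≤i') | no q rewrite moved p | fixed q = moved-above-fixed i≤r r≤i' q s↓
    ... | no p | yes q rewrite fixed p | moved q = m≤n⇒m≤1+n (col-strict r c s s↓)
    ... | no p | no q  rewrite fixed p | fixed q = col-strict r c s s↓

    below-row′ : ∀ r c → Sk (r , c) → T' r c < r
    below-row′ r c s with inPiece? r c
    ... | yes p@(refl , i≤r , r≤i') rewrite moved p = moved-below-row i≤r r≤i'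
    ... | no q rewrite fixed q = below-row r c s

    strip-shift′ : ∀ r k c → S h (r , c) → S h (r + k , c) → T' (r + k) c ≡ T' r c + k
    strip-shift′ r k c s s' with c ≟ j
    ... | yes refl rewrite moved (refl , piece-range r s) | moved (refl , piece-range (r + k) s') =
      cong suc (strip-shift r k c s s')
    ... | no c≢j rewrite fixed {r} (c≢j ∘ proj₁) | fixed {r + k} (c≢j ∘ proj₁) = strip-shift r k c s s'

    invariant′ : Invariant h T'
    invariant′ = record
      { row-weak = row-weak′ ; col-strict = col-strict′ ; below-row = below-row′ ; strip-shift = strip-shift′ }

  SSYTmin-invariant : ∀ {f b T} → 1 ≤ f → SSYTmin λ′ μ (f , b) T → Invariant (f , b) T
  SSYTmin-invariant _   base             = T₀-invariant
  SSYTmin-invariant 1≤f (move t act mv) = MovePreserves.invariant′ 1≤f (SSYTmin-invariant 1≤f t) act mv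

  invariant⇒SF : ∀ {h T} → Invariant h T → InSF λ′ μ (plusOne T)
  invariant⇒SF inv =
    ((λ i j s s→ → s≤s (row-weak i j s s→)) , (λ i j s s↓ → s≤s (col-strict i j s s↓)))
    , λ r c s → s≤s z≤n , below-row r c s
    where open Invariant inv

lemma5p2 : (λ′ μ : List ℕ) → IsPartition λ′ → IsPartition μ
    → (∀ i → part μ i ≤ part λ′ i) → Connected λ′ μ
    → (h : Cell) → IsLastHead λ′ μ h
    → (T : Tableau) → SSYTmin λ′ μ h T → InSF λ′ μ (plusOne T)
lemma5p2 λ′ μ (λ↓ , _) (μ↓ , _) _ _ (f , b) ((((1≤f , _) , _) , _) , _) _ t =
  invariant⇒SF (SSYTmin-invariant 1≤f t)
  where open SkewShape λ↓ μ↓
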